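{- (1) If $T\in\mathbb T$, then $d(T)=\oslash$. (2) Let $U\in\mathbb U$ with $d(U)=L$. Then $U=\omega^L$ or $U=\vec e_L\sqcap_{i=1}^pT_i$ with $p\ge1$ and $T_i\in\mathbb T$ for all $i$. (3) Let $U_1\sqsubseteq U_2$. Then: (a) $d(U_1)=d(U_2)$; (b) if $U_1=\omega^K$ then $U_2=\omega^K$; (c) if $U_1=\vec e_KU$ then $U_2=\vec e_KU'$ with $U\sqsubseteq U'$; (d) if $U_2=\vec e_KU$ then $U_1=\vec e_KU'$ with $U'\sqsubseteq U$; (e) if $U_1=\sqcap_{i=1}^p\vec e_K(U_i\to T_i)$ with $p\ge1$, then $U_2=\omega^K$ or $U_2=\sqcap_{j=1}^q\vec e_K(U'_j\to T'_j)$ with $q\ge1$ and for every $j\in\{1,\dots,q\}$ there is $i\in\{1,\dots,p\}$ with $U'_j\sqsubseteq U_i$ and $T_i\sqsubseteq T'_j$. (4) If $U\in\mathbb U$ and $d(U)=L$ then $U\sqsubseteq\omega^L$. (5) If $U\sqsubseteq U_1'\sqcap U_2'$ then $U=U_1\sqcap U_2$ with $U_1\sqsubseteq U_1'$ and $U_2\sqsubseteq U_2'$. (6) If $\Gamma\sqsubseteq\Gamma_1'\sqcap\Gamma_2'$ then $\Gamma=\Gamma_1\sqcap\Gamma_2$ with $\Gamma_1\sqsubseteq\Gamma_1'$ and $\Gamma_2\sqsubseteq\Gamma_2'$.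
   Context: Indexes: finite sequences of natural numbers ($\mathcal L_{\mathbb N}$), $\oslash$ empty, $i::L$ prepending $i$, $L::K$ concatenation. Types: $\mathcal A$ is a countably infinite set of atomic types and $\overline e_0,\overline e_1,\dots$ are expansion variables. Sets $\mathbb T\subseteq\mathbb U$ and degree $d:\mathbb U\to\mathcal L_{\mathbb N}$: $a\in\mathbb T$ with $d(a)=\oslash$ for $a\in\mathcal A$; if $U\in\mathbb U,T\in\mathbb T$ then $U\to T\in\mathbb T$ with $d(U\to T)=\oslash$; $\omega^L\in\mathbb U$ with $d(\omega^L)=L$; if $U_1,U_2\in\mathbb U$ with $d(U_1)=d(U_2)$ then $U_1\sqcap U_2\in\mathbb U$ of that degree; if $U\in\mathbb U$ then $\overline e_iU\in\mathbb U$ with $d(\overline e_iU)=i::d(U)$. Types are quotiented by: $\sqcap$ commutative, associative, idempotent; $\overline e_i(U_1\sqcap U_2)=\overline e_iU_1\sqcap\overline e_iU_2$; $\omega^L\sqcap U=U$ when $d(U)=L$; $\overline e_i\omega^K=\omega^{i::K}$. For $K=(i_1,\dots,i_n)$, $\vec e_KU$ denotes $\overline e_{i_1}\cdots\overline e_{i_n}U$; $\sqcap_{i=1}^pU_i=U_1\sqcap\dots\sqcap U_p$. Environments: finite sets of declarations $x^L:U$ ($x$ a variable, $L$ an index, $U\in\mathbb U$), at most one type per $x^L$; $\Gamma,\Delta$ is union with disjoint domains; $\Gamma_1\sqcap\Gamma_2$ assigns $U\sqcap U'$ to $x^L$ declared with $U$ in $\Gamma_1$ and $U'$ in $\Gamma_2$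 (of equal degree), and keeps other declarations. Subtyping $\sqsubseteq$ is the least relation on types, on environments and on typings $\langle\Gamma\vdash U\rangle$ closed under: reflexivity; transitivity; $U_1\sqcap U_2\sqsubseteq U_1$ if $d(U_1)=d(U_2)$; $U_1\sqcap U_2\sqsubseteq V_1\sqcap V_2$ if $U_1\sqsubseteq V_1$, $U_2\sqsubseteq V_2$; $U_1\to T_1\sqsubseteq U_2\to T_2$ if $U_2\sqsubseteq U_1$ and $T_1\sqsubseteq T_2$; $\overline e_iU_1\sqsubseteq\overline e_iU_2$ if $U_1\sqsubseteq U_2$; $\Gamma,y^L:U_1\sqsubseteq\Gamma,y^L:U_2$ if $U_1\sqsubseteq U_2$; $\langle\Gamma_1\vdash U_1\rangle\sqsubseteq\langle\Gamma_2\vdash U_2\rangle$ if $U_1\sqsubseteq U_2$ and $\Gamma_2\sqsubseteq\Gamma_1$. -}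

module Defs where

open import Data.Nat using (ℕ; suc; zero)
open import Data.Nat.Properties using () renaming (_≟_ to _≟ℕ_)
open import Data.List using (List; []; _∷_)
open import Data.List.Properties using (≡-dec)
open import Data.List.Membership.Propositional using (_∈_)
open import Data.Fin using (Fin; zero; suc)
open import Data.Maybe using (Maybe; just; nothing)
open import Data.Product using (Σ; _×_; _,_; ∃)
open import Data.Sum using (_⊎_)
open import Relation.Nullary using (yes; no)
open import Relation.Binary.PropositionalEquality using (_≡_)

-- Indexes: finite sequences of naturals; ⊘ = [], i::L = i ∷ L.

Index : Set
Index = List ℕ

-- The paper's types are equivalence classes of these raw terms modulo
-- _≈_ below; a raw term stands for its class.

infixr 7 _⇒_
infixl 6 _⊓_

data Ty : Set where
  atom : ℕ → Ty
  _⇒_  : Ty → Ty → Ty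
  ω    : Index → Ty
  _⊓_  : Ty → Ty → Ty
  e    : ℕ → Ty → Ty

mutual
  data IsT : Ty → Set where
    atomT : ∀ a → IsT (atom a)
    arrT  : ∀ {U T L} → HasDeg U L → IsT T → IsT (U ⇒ T)

  -- HasDeg U L : "U ∈ 𝕌 (raw) with d(U) = L"
  data HasDeg : Ty → Index → Set where
    fromT : ∀ {T} → IsT T → HasDeg T []
    ωD    : ∀ L → HasDeg (ω L) L
    ⊓D    : ∀ {U₁ U₂ L} → HasDeg U₁ L → HasDeg U₂ L → HasDeg (U₁ ⊓ U₂) L
    eD    : ∀ {U L} i → HasDeg U L → HasDeg (e i U) (i ∷ L)

infix 4 _≈_
data _≈_ : Ty → Ty → Set where
  ≈-refl  : ∀ {U} → U ≈ U
  ≈-sym   : ∀ {U V} → U ≈ V → V ≈ U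
  ≈-trans : ∀ {U V W} → U ≈ V → V ≈ W → U ≈ W
  ⇒-cong  : ∀ {U U' T T'} → U ≈ U' → T ≈ T' → (U ⇒ T) ≈ (U' ⇒ T')
  ⊓-cong  : ∀ {U U' V V'} → U ≈ U' → V ≈ V' → (U ⊓ V) ≈ (U' ⊓ V')
  e-cong  : ∀ {U U'} i → U ≈ U' → e i U ≈ e i U'
  ⊓-comm  : ∀ U V → U ⊓ V ≈ V ⊓ U
  ⊓-assoc : ∀ U V W → (U ⊓ V) ⊓ W ≈ U ⊓ (V ⊓ W)
  ⊓-idem  : ∀ U → U ⊓ U ≈ U
  e-distr : ∀ i U V → e i (U ⊓ V) ≈ e i U ⊓ e i V
  ω-unit  : ∀ {U L} → HasDeg U L → ω L ⊓ U ≈ U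
  e-ω     : ∀ i K → e i (ω K) ≈ ω (i ∷ K)

-- Class-level notions (a class is in 𝕋 / 𝕌 iff it has a representative
-- built by the formation rules; d of a class is the degree of such a
-- representative).

InT : Ty → Set
InT U = Σ Ty λ V → U ≈ V × IsT V

infix 4 _hasDegree_
_hasDegree_ : Ty → Index → Set
U hasDegree L = Σ Ty λ V → U ≈ V × HasDeg V L

InU : Ty → Set
InU U = Σ Index λ L → U hasDegree L

ek : Index → Ty → Ty
ek []      U = U
ek (i ∷ K) U = e i (ek K U)

-- ⊓_{i=1}^{suc n} f i  (a nonempty meet, p = suc n ≥ 1)
⨅ : (n : ℕ) → (Fin (suc n) → Ty) → Ty
⨅ zero    f = f zero
⨅ (suc n) f = f zero ⊓ ⨅ n (λ i → f (suc i))

-- Subtyping on types (relating elements of 𝕌; side conditions that the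
-- paper leaves implicit, namely that all types involved are in 𝕌 / 𝕋,
-- are made explicit).

infix 4 _⊑_
data _⊑_ : Ty → Ty → Set where
  ⊑-refl  : ∀ {U V} → InU U → U ≈ V → U ⊑ V
  ⊑-trans : ∀ {U V W} → U ⊑ V → V ⊑ W → U ⊑ W
  ⊑-⊓ᵉ    : ∀ {U₁ U₂ L} → U₁ hasDegree L → U₂ hasDegree L → U₁ ⊓ U₂ ⊑ U₁
  ⊑-⊓     : ∀ {U₁ U₂ V₁ V₂} → InU (U₁ ⊓ U₂) → InU (V₁ ⊓ V₂) →
            U₁ ⊑ V₁ → U₂ ⊑ V₂ → U₁ ⊓ U₂ ⊑ V₁ ⊓ V₂
  ⊑-⇒     : ∀ {U₁ U₂ T₁ T₂} → InT T₁ → InT T₂ →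
            U₂ ⊑ U₁ → T₁ ⊑ T₂ → U₁ ⇒ T₁ ⊑ U₂ ⇒ T₂
  ⊑-e     : ∀ {U₁ U₂} i → U₁ ⊑ U₂ → e i U₁ ⊑ e i U₂

-- Environments: partial maps from declarations x^L (x : ℕ a variable,
-- L an index) to types; at most one type per x^L by construction.

Env : Set
Env = ℕ → Index → Maybe Ty

Finite : Env → Set
Finite Γ = Σ (List (ℕ × Index)) λ ks → ∀ x L U → Γ x L ≡ just U → (x , L) ∈ ks

EnvOK : Env → Set
EnvOK Γ = Finite Γ × (∀ x L U → Γ x L ≡ just U → InU U)

data _≈ᵐ_ : Maybe Ty → Maybe Ty → Set where
  nothing≈ : nothing ≈ᵐ nothing
  just≈    : ∀ {U V} → U ≈ V → just U ≈ᵐ just V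

infix 4 _≈ₑ_
_≈ₑ_ : Env → Env → Set
Γ ≈ₑ Δ = ∀ x L → Γ x L ≈ᵐ Δ x L

-- Γ, y^L : U   (only used when y^L ∉ dom Γ)
extend : Env → ℕ → Index → Ty → Env
extend Γ y L U x K with y ≟ℕ x | ≡-dec _≟ℕ_ L K
... | yes _ | yes _ = just U
... | _     | _     = Γ x K

-- Γ₁ ⊓ Γ₂ (it denotes an environment when EnvOK (Γ₁ ⊓ₑ Γ₂), i.e. when
-- shared declarations have types of equal degree)
meetᵐ : Maybe Ty → Maybe Ty → Maybe Ty
meetᵐ (just U) (just V) = just (U ⊓ V)
meetᵐ (just U) nothing  = just U
meetᵐ nothing  m        = m

infixl 6 _⊓ₑ_
_⊓ₑ_ : Env → Env → Env
(Γ₁ ⊓ₑ Γ₂) x L = meetᵐ (Γ₁ x L) (Γ₂ x L)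

infix 4 _⊑ₑ_
data _⊑ₑ_ : Env → Env → Set where
  ⊑ₑ-refl  : ∀ {Γ Δ} → EnvOK Γ → Γ ≈ₑ Δ → Γ ⊑ₑ Δ
  ⊑ₑ-trans : ∀ {Γ Δ Θ} → Γ ⊑ₑ Δ → Δ ⊑ₑ Θ → Γ ⊑ₑ Θ
  ⊑ₑ-ext   : ∀ {Γ y L U₁ U₂} → EnvOK Γ → Γ y L ≡ nothing → U₁ ⊑ U₂ →
             extend Γ y L U₁ ⊑ₑ extend Γ y L U₂

Part1 : Set
Part1 = ∀ T L → InT T → T hasDegree L → L ≡ []

Part2 : Set
Part2 = ∀ U L → InU U → U hasDegree L →
        U ≈ ω L ⊎
        Σ ℕ λ n → Σ (Fin (suc n) → Ty) λ Ts →
          (∀ i → InT (Ts i)) × U ≈ ek L (⨅ n Ts)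

Part3 : Set
Part3 = ∀ U₁ U₂ → U₁ ⊑ U₂ →
  (∀ L L' → U₁ hasDegree L → U₂ hasDegree L' → L ≡ L') ×
  (∀ K → U₁ ≈ ω K → U₂ ≈ ω K) ×
  (∀ K U → InU U → U₁ ≈ ek K U →
     Σ Ty λ U' → InU U' × U₂ ≈ ek K U' × U ⊑ U') ×
  (∀ K U → InU U → U₂ ≈ ek K U →
     Σ Ty λ U' → InU U' × U₁ ≈ ek K U' × U' ⊑ U) ×
  (∀ K n (Us Ts : Fin (suc n) → Ty) →
     (∀ i → InU (Us i)) → (∀ i → InT (Ts i)) →
     U₁ ≈ ⨅ n (λ i → ek K (Us i ⇒ Ts i)) →
     U₂ ≈ ω K ⊎
     Σ ℕ λ m → Σ (Fin (suc m) → Ty) λ Us' → Σ (Fin (suc m) → Ty) λ Ts' →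
       (∀ j → InU (Us' j)) × (∀ j → InT (Ts' j)) ×
       U₂ ≈ ⨅ m (λ j → ek K (Us' j ⇒ Ts' j)) ×
       (∀ j → Σ (Fin (suc n)) λ i → Us' j ⊑ Us i × Ts i ⊑ Ts' j))

Part4 : Set
Part4 = ∀ U L → InU U → U hasDegree L → U ⊑ ω L

Part5 : Set
Part5 = ∀ U U₁' U₂' → U ⊑ U₁' ⊓ U₂' →
        Σ Ty λ U₁ → Σ Ty λ U₂ → U ≈ U₁ ⊓ U₂ × U₁ ⊑ U₁' × U₂ ⊑ U₂'

Part6 : Set
Part6 = ∀ Γ Γ₁' Γ₂' → EnvOK Γ₁' → EnvOK Γ₂' → EnvOK (Γ₁' ⊓ₑ Γ₂') →
        Γ ⊑ₑ Γ₁' ⊓ₑ Γ₂' →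
        Σ Env λ Γ₁ → Σ Env λ Γ₂ →
          EnvOK Γ₁ × EnvOK Γ₂ × EnvOK (Γ₁ ⊓ₑ Γ₂) ×
          Γ ≈ₑ Γ₁ ⊓ₑ Γ₂ × Γ₁ ⊑ₑ Γ₁' × Γ₂ ⊑ₑ Γ₂'

module Submission where

-- Types are raw terms quotiented by _≈_, and _⊑_ is generated by rules, so
-- each part of the lemma is proved by attaching to raw terms invariants that
-- are preserved by _≈_ (and by _⊑_) and reading the parts off them:
--
-- * the degree  deg : Ty → Maybe Index  (a partial function agreeing with
--   HasDeg) is invariant under _≈_ and _⊑_; this gives (1) and (3a);
-- * the list of components of U records every atom or arrow of U together
--   with the expansion variables above it.  A well-formed U of degree L
--   equals  ek L  of the meet of its components (normal form), giving (2);
--   (4) is immediate from ω^L ⊓ U = U;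
-- * a recursive "same components" relation _≋_ is sound for _≈_ and, on
--   well-formed types, complete; so components and membership in 𝕋 and 𝕌
--   can be transported along _≈_;
-- * if U ⊑ V then every component of V lies above a component of U at the
--   same position (simulation); with the normal form this gives (3b), (3e);
-- * removing the outer expansions of a given index respects _≈_ and _⊑_,
--   giving (3c) and (3d);
-- * (5) holds with U₁ = U₂ = U by idempotence, and (6) follows, pointwise,
--   from the characterisation of environment subtyping as pointwise
--   subtyping of well-formed environments.

open import Defs
open import Data.Nat using (ℕ; zero; suc)
open import Data.Nat.Properties using (_≟_)
open import Data.List using (List; []; _∷_; _++_; map; lookup; length)
open import Data.List.Properties using (≡-dec; ++-identityʳ; ++-assoc; map-++; ∷-injectiveʳ)
open import Data.List.Membership.Propositional using (_∈_)
open import Data.List.Membership.Propositional.Properties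
  using (∈-++⁺ˡ; ∈-++⁺ʳ; ∈-++⁻; ∈-map⁺; ∈-map⁻; ∈-lookup)
open import Data.List.Relation.Binary.Subset.Propositional using (_⊆_)
open import Data.List.Relation.Binary.Subset.Propositional.Properties
  using (⊆-reflexive; ⊆-reflexive-↭; xs⊆xs++ys; xs⊆ys++xs; ⊆[]⇒≡[])
open import Data.List.Relation.Binary.Permutation.Propositional.Properties using (++-comm)
open import Data.List.Relation.Unary.Any using (here; there)
open import Data.Fin using (Fin; zero; suc)
open import Data.Maybe using (Maybe; just; nothing)
import Data.Maybe as Maybe
open import Data.Maybe.Properties using (just-injective)
open import Data.Product using (Σ; _×_; _,_; proj₁; proj₂)
open import Data.Product.Properties using () renaming (≡-dec to ×-≡-dec)
open import Data.Sum using (_⊎_; inj₁; inj₂; [_,_]′)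
open import Data.Empty using (⊥-elim)
open import Relation.Nullary using (Dec; yes; no; ¬_)
open import Relation.Binary.PropositionalEquality
open import Relation.Binary.Bundles using (Setoid)
import Relation.Binary.Reasoning.Setoid as SetoidReasoning

meetDeg : Maybe Index → Maybe Index → Maybe Index
meetDeg (just L) (just K) with ≡-dec _≟_ L K
... | yes _ = just L
... | no _  = nothing
meetDeg _ _ = nothing

deg : Ty → Maybe Index
deg (atom a) = just []
deg (U ⇒ T)  = just []
deg (ω L)    = just L
deg (U ⊓ V)  = meetDeg (deg U) (deg V)
deg (e i U)  = Maybe.map (i ∷_) (deg U)

meetDeg-same : ∀ L → meetDeg (just L) (just L) ≡ just L
meetDeg-same L with ≡-dec _≟_ L L
... | yes _  = refl
... | no L≢L = ⊥-elim (L≢L refl)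

meetDeg-split : ∀ a b {L} → meetDeg a b ≡ just L → (a ≡ just L) × (b ≡ just L)
meetDeg-split (just L) (just K) eq with ≡-dec _≟_ L K
meetDeg-split (just L) (just .L) refl | yes refl = refl , refl
meetDeg-split (just L) (just K) ()    | no _
meetDeg-split (just L) nothing ()
meetDeg-split nothing b ()

meetDeg-comm : ∀ a b → meetDeg a b ≡ meetDeg b a
meetDeg-comm (just L) (just K) with ≡-dec _≟_ L K | ≡-dec _≟_ K L
... | yes refl | yes _    = refl
... | yes refl | no K≢L   = ⊥-elim (K≢L refl)
... | no L≢K   | yes refl = ⊥-elim (L≢K refl)
... | no _     | no _     = refl
meetDeg-comm (just L) nothing  = refl
meetDeg-comm nothing  (just K) = refl
meetDeg-comm nothing  nothing  = refl

meetDeg-nothingʳ : ∀ a → meetDeg a nothing ≡ nothing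
meetDeg-nothingʳ (just _) = refl
meetDeg-nothingʳ nothing  = refl

meetDeg-assoc : ∀ a b c → meetDeg (meetDeg a b) c ≡ meetDeg a (meetDeg b c)
meetDeg-assoc nothing b c = refl
meetDeg-assoc (just L) nothing c = refl
meetDeg-assoc (just L) (just K) nothing = meetDeg-nothingʳ (meetDeg (just L) (just K))
meetDeg-assoc (just L) (just K) (just M) with ≡-dec _≟_ L K | ≡-dec _≟_ K M
meetDeg-assoc (just L) (just .L) (just .L) | yes refl | yes refl rewrite meetDeg-same L = refl
meetDeg-assoc (just L) (just .L) (just M) | yes refl | no L≢M with ≡-dec _≟_ L M
... | yes refl = ⊥-elim (L≢M refl)
... | no _     = refl
meetDeg-assoc (just L) (just K) (just .K) | no L≢K | yes refl with ≡-dec _≟_ L K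
... | yes refl = ⊥-elim (L≢K refl)
... | no _     = refl
meetDeg-assoc (just L) (just K) (just M) | no _ | no _ = refl

meetDeg-idem : ∀ a → meetDeg a a ≡ a
meetDeg-idem (just L) = meetDeg-same L
meetDeg-idem nothing  = refl

meetDeg-prefix : ∀ i a b →
  Maybe.map (i ∷_) (meetDeg a b) ≡ meetDeg (Maybe.map (i ∷_) a) (Maybe.map (i ∷_) b)
meetDeg-prefix i (just L) (just K) with ≡-dec _≟_ L K | ≡-dec _≟_ (i ∷ L) (i ∷ K)
... | yes refl | yes _   = refl
... | yes refl | no iL≢iL = ⊥-elim (iL≢iL refl)
... | no L≢K   | yes iL≡iK = ⊥-elim (L≢K (∷-injectiveʳ iL≡iK))
... | no _     | no _    = refl
meetDeg-prefix i (just L) nothing = refl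
meetDeg-prefix i nothing b = refl

prefix-just : ∀ {i : ℕ} {m : Maybe Index} {L} →
  Maybe.map (i ∷_) m ≡ just L → Σ Index λ M → (m ≡ just M) × (L ≡ i ∷ M)
prefix-just {m = just M} refl = M , refl , refl

IsT⇒deg : ∀ {T} → IsT T → deg T ≡ just []
IsT⇒deg (atomT a)  = refl
IsT⇒deg (arrT _ _) = refl

HasDeg⇒deg : ∀ {U L} → HasDeg U L → deg U ≡ just L
HasDeg⇒deg (fromT t) = IsT⇒deg t
HasDeg⇒deg (ωD L)    = refl
HasDeg⇒deg (⊓D {L = L} h₁ h₂) rewrite HasDeg⇒deg h₁ | HasDeg⇒deg h₂ = meetDeg-same L
HasDeg⇒deg (eD i h) rewrite HasDeg⇒deg h = refl

deg-≈ : ∀ {U V} → U ≈ V → deg U ≡ deg V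
deg-≈ ≈-refl          = refl
deg-≈ (≈-sym p)       = sym (deg-≈ p)
deg-≈ (≈-trans p q)   = trans (deg-≈ p) (deg-≈ q)
deg-≈ (⇒-cong p q)    = refl
deg-≈ (⊓-cong p q)    = cong₂ meetDeg (deg-≈ p) (deg-≈ q)
deg-≈ (e-cong i p)    = cong (Maybe.map (i ∷_)) (deg-≈ p)
deg-≈ (⊓-comm U V)    = meetDeg-comm (deg U) (deg V)
deg-≈ (⊓-assoc U V W) = meetDeg-assoc (deg U) (deg V) (deg W)
deg-≈ (⊓-idem U)      = meetDeg-idem (deg U)
deg-≈ (e-distr i U V) = meetDeg-prefix i (deg U) (deg V)
deg-≈ (ω-unit {L = L} h) rewrite HasDeg⇒deg h = meetDeg-same L
deg-≈ (e-ω i K)       = refl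

hasDegree⇒deg : ∀ {U L} → U hasDegree L → deg U ≡ just L
hasDegree⇒deg (V , U≈V , h) = trans (deg-≈ U≈V) (HasDeg⇒deg h)

hasDegree-unique : ∀ {U L K} → U hasDegree L → deg U ≡ just K → L ≡ K
hasDegree-unique h d = just-injective (trans (sym (hasDegree⇒deg h)) d)

InU⇒deg : ∀ {U} → (u : InU U) → deg U ≡ just (proj₁ u)
InU⇒deg (L , h) = hasDegree⇒deg h

deg-ek : ∀ K {U M} → deg U ≡ just M → deg (ek K U) ≡ just (K ++ M)
deg-ek []      d = d
deg-ek (i ∷ K) d = cong (Maybe.map (i ∷_)) (deg-ek K d)

part1 : Part1
part1 T L (V , T≈V , t) h = hasDegree-unique h (trans (deg-≈ T≈V) (IsT⇒deg t))

TySetoid : Setoid _ _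
TySetoid = record
  { Carrier       = Ty
  ; _≈_           = _≈_
  ; isEquivalence = record { refl = ≈-refl ; sym = ≈-sym ; trans = ≈-trans }
  }

module ≈-Reasoning = SetoidReasoning TySetoid

infixr 5 _∙_
_∙_ : ∀ {U V W} → U ≈ V → V ≈ W → U ≈ W
_∙_ = ≈-trans

≡⇒≈ : ∀ {U V} → U ≡ V → U ≈ V
≡⇒≈ refl = ≈-refl

hasDegree-≈ : ∀ {U V L} → U hasDegree L → U ≈ V → V hasDegree L
hasDegree-≈ (W , U≈W , h) U≈V = W , ≈-sym U≈V ∙ U≈W , h

InU-≈ : ∀ {U V} → InU U → U ≈ V → InU V
InU-≈ (L , h) U≈V = L , hasDegree-≈ h U≈V

InT⇒InU : ∀ {T} → InT T → InU T
InT⇒InU (W , T≈W , t) = [] , W , T≈W , fromT t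

hasDegree⇒InU : ∀ {U L} → U hasDegree L → InU U
hasDegree⇒InU {L = L} h = L , h

⇒-InT : ∀ {U T} → InU U → InT T → InT (U ⇒ T)
⇒-InT (L , W , U≈W , h) (W' , T≈W' , t) = W ⇒ W' , ⇒-cong U≈W T≈W' , arrT h t

e-InU : ∀ i {U} → InU U → InU (e i U)
e-InU i (L , W , U≈W , h) = i ∷ L , e i W , e-cong i U≈W , eD i h

ek-cong : ∀ K {U V} → U ≈ V → ek K U ≈ ek K V
ek-cong []      p = p
ek-cong (i ∷ K) p = e-cong i (ek-cong K p)

ek-distr : ∀ K U V → ek K (U ⊓ V) ≈ ek K U ⊓ ek K V
ek-distr []      U V = ≈-refl
ek-distr (i ∷ K) U V = e-cong i (ek-distr K U V) ∙ e-distr i _ _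

ek-ω : ∀ K → ek K (ω []) ≈ ω K
ek-ω []      = ≈-refl
ek-ω (i ∷ K) = e-cong i (ek-ω K) ∙ e-ω i K

ek-⨅ : ∀ K n (f : Fin (suc n) → Ty) → ek K (⨅ n f) ≈ ⨅ n (λ i → ek K (f i))
ek-⨅ K zero    f = ≈-refl
ek-⨅ K (suc n) f = ek-distr K _ _ ∙ ⊓-cong ≈-refl (ek-⨅ K n (λ i → f (suc i)))

⨅-cong : ∀ n {f g : Fin (suc n) → Ty} → (∀ i → f i ≈ g i) → ⨅ n f ≈ ⨅ n g
⨅-cong zero    p = p zero
⨅-cong (suc n) p = ⊓-cong (p zero) (⨅-cong n (λ i → p (suc i)))

-- A component is an atom or an arrow together with the sequence of
-- expansion variables above it.
Component : Set
Component = Index × Ty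

prefix : ℕ → Component → Component
prefix i (K , T) = (i ∷ K , T)

components : Ty → List Component
components (atom a) = ([] , atom a) ∷ []
components (U ⇒ T)  = ([] , U ⇒ T) ∷ []
components (ω L)    = []
components (U ⊓ V)  = components U ++ components V
components (e i U)  = map (prefix i) (components U)

meetOf : List Component → Ty
meetOf []      = ω []
meetOf (c ∷ r) = proj₂ c ⊓ meetOf r

AllInT : List Component → Set
AllInT cs = ∀ {c} → c ∈ cs → IsT (proj₂ c)

meetOf-HasDeg : ∀ cs → AllInT cs → HasDeg (meetOf cs) []
meetOf-HasDeg []       _ = ωD []
meetOf-HasDeg (c ∷ cs) t = ⊓D (fromT (t (here refl))) (meetOf-HasDeg cs (λ m → t (there m)))

meetOf-++ : ∀ cs ds → AllInT ds → meetOf (cs ++ ds) ≈ meetOf cs ⊓ meetOf ds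
meetOf-++ []       ds t = ≈-sym (ω-unit (meetOf-HasDeg ds t))
meetOf-++ (c ∷ cs) ds t = ⊓-cong ≈-refl (meetOf-++ cs ds t) ∙ ≈-sym (⊓-assoc _ _ _)

meetOf-prefix : ∀ i cs → meetOf (map (prefix i) cs) ≡ meetOf cs
meetOf-prefix i []       = refl
meetOf-prefix i (c ∷ cs) = cong (proj₂ c ⊓_) (meetOf-prefix i cs)

components-HasDeg : ∀ {W L c} → HasDeg W L → c ∈ components W → (proj₁ c ≡ L) × IsT (proj₂ c)
components-HasDeg (fromT (atomT a))  (here refl) = refl , atomT a
components-HasDeg (fromT (arrT h t)) (here refl) = refl , arrT h t
components-HasDeg (⊓D {U₁ = U₁} h₁ h₂) m with ∈-++⁻ (components U₁) m
... | inj₁ m₁ = components-HasDeg h₁ m₁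
... | inj₂ m₂ = components-HasDeg h₂ m₂
components-HasDeg (eD i h) m with ∈-map⁻ (prefix i) m
... | c , m' , refl with components-HasDeg h m'
... | K≡L , t = cong (i ∷_) K≡L , t

components-AllInT : ∀ {W L} → HasDeg W L → AllInT (components W)
components-AllInT h m = proj₂ (components-HasDeg h m)

normalForm : ∀ {W L} → HasDeg W L → W ≈ ek L (meetOf (components W))
normalForm (fromT (atomT a))  = ≈-sym (⊓-comm _ _ ∙ ω-unit (fromT (atomT a)))
normalForm (fromT (arrT h t)) = ≈-sym (⊓-comm _ _ ∙ ω-unit (fromT (arrT h t)))
normalForm (ωD L)    = ≈-sym (ek-ω L)
normalForm (⊓D {U₁} {U₂} {L} h₁ h₂) = begin
  U₁ ⊓ U₂
    ≈⟨ ⊓-cong (normalForm h₁) (normalForm h₂) ⟩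
  ek L (meetOf (components U₁)) ⊓ ek L (meetOf (components U₂))
    ≈⟨ ek-distr L _ _ ⟨
  ek L (meetOf (components U₁) ⊓ meetOf (components U₂))
    ≈⟨ ek-cong L (meetOf-++ (components U₁) (components U₂) (components-AllInT h₂)) ⟨
  ek L (meetOf (components U₁ ++ components U₂))
    ∎
  where open ≈-Reasoning
normalForm (eD {U} i h) rewrite meetOf-prefix i (components U) = e-cong i (normalForm h)

meetOf-⨅ : ∀ c cs → AllInT (c ∷ cs) → meetOf (c ∷ cs) ≈ ⨅ (length cs) (λ j → proj₂ (lookup (c ∷ cs) j))
meetOf-⨅ c []       t = ⊓-comm _ _ ∙ ω-unit (fromT (t (here refl)))
meetOf-⨅ c (d ∷ ds) t = ⊓-cong ≈-refl (meetOf-⨅ d ds (λ m → t (there m)))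

part2 : Part2
part2 U L _ (W , U≈W , h) with components W | normalForm h | components-AllInT h
... | []     | W≈nf | _ = inj₁ (U≈W ∙ W≈nf ∙ ek-ω L)
... | c ∷ cs | W≈nf | t = inj₂ (length cs , (λ j → proj₂ (lookup (c ∷ cs) j)) ,
                               (λ j → _ , ≈-refl , t (∈-lookup j)) ,
                               U≈W ∙ W≈nf ∙ ek-cong L (meetOf-⨅ c cs t))

-- Part (4): ω^L is a top element among types of degree L, since ω^L ⊓ U = U.
part4 : Part4
part4 U L u h@(W , U≈W , hW) =
  ⊑-trans (⊑-refl u (≈-sym (⊓-cong ≈-refl U≈W ∙ ω-unit hW ∙ ≈-sym U≈W)))
          (⊑-⊓ᵉ (ω L , ≈-refl , ωD L) h)

mutual
  data _≋_ (U V : Ty) : Set where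
    same : deg U ≡ deg V →
           (∀ {c} → c ∈ components U → Matched (components V) c) →
           (∀ {d} → d ∈ components V → MatchedBy (components U) d) → U ≋ V

  data Matched (ds : List Component) (c : Component) : Set where
    matched : ∀ {d} → d ∈ ds → c ≋ᶜ d → Matched ds c

  data MatchedBy (cs : List Component) (d : Component) : Set where
    matchedBy : ∀ {c} → c ∈ cs → c ≋ᶜ d → MatchedBy cs d

  data _≋ᶜ_ : Component → Component → Set where
    atom≋  : ∀ K a → (K , atom a) ≋ᶜ (K , atom a)
    arrow≋ : ∀ K {A B A' B'} → A ≋ A' → B ≋ B' → (K , A ⇒ B) ≋ᶜ (K , A' ⇒ B')

prefix-≋ᶜ : ∀ i {c d} → c ≋ᶜ d → prefix i c ≋ᶜ prefix i d
prefix-≋ᶜ i (atom≋ K a)      = atom≋ (i ∷ K) a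
prefix-≋ᶜ i (arrow≋ K p q) = arrow≋ (i ∷ K) p q

Matched-⊆ : ∀ {ds ds' c} → ds ⊆ ds' → Matched ds c → Matched ds' c
Matched-⊆ sub (matched m p) = matched (sub m) p

MatchedBy-⊆ : ∀ {cs cs' d} → cs ⊆ cs' → MatchedBy cs d → MatchedBy cs' d
MatchedBy-⊆ sub (matchedBy m p) = matchedBy (sub m) p

Matched-prefix : ∀ i {ds c} → Matched ds c → Matched (map (prefix i) ds) (prefix i c)
Matched-prefix i (matched m p) = matched (∈-map⁺ (prefix i) m) (prefix-≋ᶜ i p)

MatchedBy-prefix : ∀ i {cs d} → MatchedBy cs d → MatchedBy (map (prefix i) cs) (prefix i d)
MatchedBy-prefix i (matchedBy m p) = matchedBy (∈-map⁺ (prefix i) m) (prefix-≋ᶜ i p)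

mutual
  ≋-refl : ∀ U → U ≋ U
  ≋-refl U = same refl (λ m → matched m (≋ᶜ-refl U m)) (λ m → matchedBy m (≋ᶜ-refl U m))

  ≋ᶜ-refl : ∀ U {c} → c ∈ components U → c ≋ᶜ c
  ≋ᶜ-refl (atom a) (here refl) = atom≋ [] a
  ≋ᶜ-refl (U ⇒ T)  (here refl) = arrow≋ [] (≋-refl U) (≋-refl T)
  ≋ᶜ-refl (U ⊓ V) m with ∈-++⁻ (components U) m
  ... | inj₁ m₁ = ≋ᶜ-refl U m₁
  ... | inj₂ m₂ = ≋ᶜ-refl V m₂
  ≋ᶜ-refl (e i U) m with ∈-map⁻ (prefix i) m
  ... | c , m' , refl = prefix-≋ᶜ i (≋ᶜ-refl U m')

mutual
  ≋-sym : ∀ {U V} → U ≋ V → V ≋ U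
  ≋-sym (same d f g) = same (sym d) (λ m → MatchedBy⇒Matched (g m)) (λ m → Matched⇒MatchedBy (f m))

  MatchedBy⇒Matched : ∀ {cs d} → MatchedBy cs d → Matched cs d
  MatchedBy⇒Matched (matchedBy m p) = matched m (≋ᶜ-sym p)

  Matched⇒MatchedBy : ∀ {ds c} → Matched ds c → MatchedBy ds c
  Matched⇒MatchedBy (matched m p) = matchedBy m (≋ᶜ-sym p)

  ≋ᶜ-sym : ∀ {c d} → c ≋ᶜ d → d ≋ᶜ c
  ≋ᶜ-sym (atom≋ K a)    = atom≋ K a
  ≋ᶜ-sym (arrow≋ K p q) = arrow≋ K (≋-sym p) (≋-sym q)

mutual
  ≋-trans : ∀ {U V W} → U ≋ V → V ≋ W → U ≋ W
  ≋-trans (same d f g) (same d' f' g') =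
    same (trans d d') (λ m → Matched-trans (f m) f') (λ m → MatchedBy-trans (g' m) g)

  Matched-trans : ∀ {ds es c} → Matched ds c → (∀ {d} → d ∈ ds → Matched es d) → Matched es c
  Matched-trans (matched m p) f with f m
  ... | matched m' q = matched m' (≋ᶜ-trans p q)

  MatchedBy-trans : ∀ {ds cs e} → MatchedBy ds e → (∀ {d} → d ∈ ds → MatchedBy cs d) → MatchedBy cs e
  MatchedBy-trans (matchedBy m q) g with g m
  ... | matchedBy m' p = matchedBy m' (≋ᶜ-trans p q)

  ≋ᶜ-trans : ∀ {c d e} → c ≋ᶜ d → d ≋ᶜ e → c ≋ᶜ e
  ≋ᶜ-trans (atom≋ K a)    (atom≋ .K .a)    = atom≋ K a
  ≋ᶜ-trans (arrow≋ K p q) (arrow≋ .K p' q') = arrow≋ K (≋-trans p p') (≋-trans q q')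

≋-⊆ : ∀ {U V} → deg U ≡ deg V → components U ⊆ components V → components V ⊆ components U → U ≋ V
≋-⊆ {U} {V} d sub sup = same d (λ m → matched (sub m) (≋ᶜ-refl U m)) (λ m → matchedBy (sup m) (≋ᶜ-refl V m))

≋-⊓-cong : ∀ {U U' V V'} → U ≋ U' → V ≋ V' → (U ⊓ V) ≋ (U' ⊓ V')
≋-⊓-cong {U} {U'} {V} {V'} (same d f g) (same d' f' g') = same (cong₂ meetDeg d d') forward backward
  where
  forward : ∀ {c} → c ∈ components U ++ components V → Matched (components U' ++ components V') c
  forward m with ∈-++⁻ (components U) m
  ... | inj₁ m₁ = Matched-⊆ (xs⊆xs++ys _ _) (f m₁)
  ... | inj₂ m₂ = Matched-⊆ (xs⊆ys++xs _ _) (f' m₂)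
  backward : ∀ {d} → d ∈ components U' ++ components V' → MatchedBy (components U ++ components V) d
  backward m with ∈-++⁻ (components U') m
  ... | inj₁ m₁ = MatchedBy-⊆ (xs⊆xs++ys _ _) (g m₁)
  ... | inj₂ m₂ = MatchedBy-⊆ (xs⊆ys++xs _ _) (g' m₂)

≋-e-cong : ∀ i {U U'} → U ≋ U' → e i U ≋ e i U'
≋-e-cong i (same d f g) = same (cong (Maybe.map (i ∷_)) d) forward backward
  where
  forward : ∀ {c} → c ∈ map (prefix i) _ → Matched (map (prefix i) _) c
  forward m with ∈-map⁻ (prefix i) m
  ... | c , m' , refl = Matched-prefix i (f m')
  backward : ∀ {d} → d ∈ map (prefix i) _ → MatchedBy (map (prefix i) _) d
  backward m with ∈-map⁻ (prefix i) m
  ... | d , m' , refl = MatchedBy-prefix i (g m')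

≈⇒≋ : ∀ {U V} → U ≈ V → U ≋ V
≈⇒≋ {U} ≈-refl      = ≋-refl U
≈⇒≋ (≈-sym p)       = ≋-sym (≈⇒≋ p)
≈⇒≋ (≈-trans p q)   = ≋-trans (≈⇒≋ p) (≈⇒≋ q)
≈⇒≋ (⇒-cong p q)    = same refl (λ { (here refl) → matched (here refl) arrow })
                                (λ { (here refl) → matchedBy (here refl) arrow })
  where arrow = arrow≋ [] (≈⇒≋ p) (≈⇒≋ q)
≈⇒≋ (⊓-cong p q)    = ≋-⊓-cong (≈⇒≋ p) (≈⇒≋ q)
≈⇒≋ (e-cong i p)    = ≋-e-cong i (≈⇒≋ p)
≈⇒≋ r@(⊓-comm U V)  = ≋-⊆ (deg-≈ r) (⊆-reflexive-↭ (++-comm (components U) (components V)))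
                                     (⊆-reflexive-↭ (++-comm (components V) (components U)))
≈⇒≋ r@(⊓-assoc U V W) = ≋-⊆ (deg-≈ r) (⊆-reflexive (++-assoc (components U) (components V) (components W)))
                                       (⊆-reflexive (sym (++-assoc (components U) (components V) (components W))))
≈⇒≋ r@(⊓-idem U)    = ≋-⊆ (deg-≈ r) (λ m → [ (λ m₁ → m₁) , (λ m₂ → m₂) ]′ (∈-++⁻ (components U) m))
                                     (xs⊆xs++ys _ _)
≈⇒≋ r@(e-distr i U V) = ≋-⊆ (deg-≈ r) (⊆-reflexive (map-++ (prefix i) (components U) (components V)))
                                       (⊆-reflexive (sym (map-++ (prefix i) (components U) (components V))))
≈⇒≋ r@(ω-unit h)    = ≋-⊆ (deg-≈ r) (λ m → m) (λ m → m)
≈⇒≋ r@(e-ω i K)     = ≋-⊆ (deg-≈ r) (λ ()) (λ ())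

meetOf-absorb-∈ : ∀ {cs c} → c ∈ cs → meetOf cs ⊓ proj₂ c ≈ meetOf cs
meetOf-absorb-∈ {c ∷ r} (here refl) =
  ⊓-cong (⊓-comm _ _) ≈-refl ∙ ⊓-assoc _ _ _ ∙ ⊓-cong ≈-refl (⊓-idem _) ∙ ⊓-comm _ _
meetOf-absorb-∈ {c ∷ r} (there m) = ⊓-assoc _ _ _ ∙ ⊓-cong ≈-refl (meetOf-absorb-∈ m)

Covers : List Component → List Component → Set
Covers cs ds = ∀ {d} → d ∈ ds → Σ Component λ c → c ∈ cs × (proj₂ d ≈ proj₂ c)

meetOf-absorb : ∀ cs ds → AllInT cs → Covers cs ds → meetOf cs ⊓ meetOf ds ≈ meetOf cs
meetOf-absorb cs []       t _   = ⊓-comm _ _ ∙ ω-unit (meetOf-HasDeg cs t)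
meetOf-absorb cs (d ∷ ds) t cov with cov (here refl)
... | c , m , d≈c = ≈-sym (⊓-assoc _ _ _)
                  ∙ ⊓-cong (⊓-cong ≈-refl d≈c ∙ meetOf-absorb-∈ m) ≈-refl
                  ∙ meetOf-absorb cs ds t (λ m' → cov (there m'))

meetOf-covers : ∀ cs ds → AllInT cs → AllInT ds → Covers cs ds → Covers ds cs → meetOf cs ≈ meetOf ds
meetOf-covers cs ds tc td cd dc = ≈-sym (meetOf-absorb cs ds tc cd) ∙ ⊓-comm _ _ ∙ meetOf-absorb ds cs td dc

-- Completeness for formed terms: by the normal form, it suffices to match
-- components, whose arrows are equal by induction.
mutual
  ≋⇒≈-HasDeg : ∀ {W W' L L'} → HasDeg W L → HasDeg W' L' → W ≋ W' → W ≈ W'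
  ≋⇒≈-HasDeg {W} {W'} {L} h h' (same d f g)
    with just-injective (trans (sym (HasDeg⇒deg h)) (trans d (HasDeg⇒deg h')))
  ... | refl = normalForm h
             ∙ ek-cong L (meetOf-covers (components W) (components W')
                            (components-AllInT h) (components-AllInT h')
                            (λ m → coveredBy h h' m (g m)) (λ m → covering h h' m (f m)))
             ∙ ≈-sym (normalForm h')

  coveredBy : ∀ {W W' L L' d} → HasDeg W L → HasDeg W' L' → d ∈ components W' →
              MatchedBy (components W) d → Σ Component λ c → c ∈ components W × (proj₂ d ≈ proj₂ c)
  coveredBy h h' md (matchedBy m p) = _ , m , ≈-sym (≋ᶜ⇒≈ p (components-AllInT h m) (components-AllInT h' md))

  covering : ∀ {W W' L L' c} → HasDeg W L → HasDeg W' L' → c ∈ components W →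
             Matched (components W') c → Σ Component λ d → d ∈ components W' × (proj₂ c ≈ proj₂ d)
  covering h h' mc (matched m p) = _ , m , ≋ᶜ⇒≈ p (components-AllInT h mc) (components-AllInT h' m)

  ≋ᶜ⇒≈ : ∀ {c d} → c ≋ᶜ d → IsT (proj₂ c) → IsT (proj₂ d) → proj₂ c ≈ proj₂ d
  ≋ᶜ⇒≈ (atom≋ K a)    _ _ = ≈-refl
  ≋ᶜ⇒≈ (arrow≋ K p q) (arrT h t) (arrT h' t') =
    ⇒-cong (≋⇒≈-HasDeg h h' p) (≋⇒≈-HasDeg (fromT t) (fromT t') q)

≋⇒≈ : ∀ {U V} → U ≋ V → InU U → InU V → U ≈ V
≋⇒≈ U≋V (L , W , U≈W , h) (L' , W' , V≈W' , h') =
  U≈W ∙ ≋⇒≈-HasDeg h h' (≋-trans (≋-sym (≈⇒≋ U≈W)) (≋-trans U≋V (≈⇒≋ V≈W'))) ∙ ≈-sym V≈W'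

rebuildDegree : ∀ U {L} → deg U ≡ just L → (∀ {c} → c ∈ components U → InT (proj₂ c)) → U hasDegree L
rebuildDegree (atom a) refl _ = atom a , ≈-refl , fromT (atomT a)
rebuildDegree (U ⇒ T)  refl t with t (here refl)
... | V , U⇒T≈V , tV = V , U⇒T≈V , fromT tV
rebuildDegree (ω K)    refl _ = ω K , ≈-refl , ωD K
rebuildDegree (U ⊓ V)  d t with meetDeg-split (deg U) (deg V) d
... | dU , dV with rebuildDegree U dU (λ m → t (∈-++⁺ˡ m))
                 | rebuildDegree V dV (λ m → t (∈-++⁺ʳ (components U) m))
... | W₁ , U≈W₁ , h₁ | W₂ , V≈W₂ , h₂ = W₁ ⊓ W₂ , ⊓-cong U≈W₁ V≈W₂ , ⊓D h₁ h₂
rebuildDegree (e i U)  d t with prefix-just {i} {deg U} d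
... | M , dU , refl with rebuildDegree U dU (λ m → t (∈-map⁺ (prefix i) m))
... | W , U≈W , h = e i W , e-cong i U≈W , eD i h

mutual
  ≋-hasDegree : ∀ {U W L} → U ≋ W → HasDeg W L → U hasDegree L
  ≋-hasDegree {U} (same d f g) h =
    rebuildDegree U (trans d (HasDeg⇒deg h)) (λ m → Matched-InT (f m) h)

  Matched-InT : ∀ {W L c} → Matched (components W) c → HasDeg W L → InT (proj₂ c)
  Matched-InT (matched m p) h = ≋ᶜ-InT p (proj₂ (components-HasDeg h m))

  ≋ᶜ-InT : ∀ {c d} → c ≋ᶜ d → IsT (proj₂ d) → InT (proj₂ c)
  ≋ᶜ-InT (atom≋ K a) _ = atom a , ≈-refl , atomT a
  ≋ᶜ-InT (arrow≋ K {A' = A'} {B' = B'} p q) (arrT h t) =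
    A' ⇒ B' , ⇒-cong (≋⇒≈ p (hasDegree⇒InU (≋-hasDegree p h)) (_ , _ , ≈-refl , h))
                     (≋⇒≈ q (hasDegree⇒InU (≋-hasDegree q (fromT t))) ([] , _ , ≈-refl , fromT t)) ,
    arrT h t

≋-InU : ∀ {U V} → U ≋ V → InU V → InU U
≋-InU U≋V (L , W , V≈W , h) = L , ≋-hasDegree (≋-trans U≋V (≈⇒≋ V≈W)) h

components-InT : ∀ {U c} → InU U → c ∈ components U → InT (proj₂ c)
components-InT (L , W , U≈W , h) m with ≈⇒≋ U≈W
... | same _ f _ = Matched-InT (f m) h

⇒-InT-inv : ∀ {A B} → InT (A ⇒ B) → InU A × InT B
⇒-InT-inv (Y , A⇒B≈Y , t) with ≈⇒≋ A⇒B≈Y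
⇒-InT-inv (Y , _ , atomT a) | same _ f _ with f (here refl)
... | matched (here refl) ()
⇒-InT-inv (Y , _ , arrT h t) | same _ f _ with f (here refl)
... | matched (here refl) (arrow≋ .[] p q) =
  ≋-InU p (_ , _ , ≈-refl , h) , (_ , ≋⇒≈ q (≋-InU q uB') uB' , t)
  where uB' = InT⇒InU (_ , ≈-refl , t)

⊑-deg : ∀ {U V} → U ⊑ V → deg U ≡ deg V
⊑-deg (⊑-refl _ U≈V) = deg-≈ U≈V
⊑-deg (⊑-trans p q)  = trans (⊑-deg p) (⊑-deg q)
⊑-deg (⊑-⊓ᵉ {L = L} h₁ h₂) rewrite hasDegree⇒deg h₁ | hasDegree⇒deg h₂ = meetDeg-same L
⊑-deg (⊑-⊓ _ _ p q)  = cong₂ meetDeg (⊑-deg p) (⊑-deg q)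
⊑-deg (⊑-⇒ _ _ _ _)  = refl
⊑-deg (⊑-e i p)      = cong (Maybe.map (i ∷_)) (⊑-deg p)

⊑-InU : ∀ {U V} → U ⊑ V → InU U × InU V
⊑-InU (⊑-refl u U≈V) = u , InU-≈ u U≈V
⊑-InU (⊑-trans p q)  = proj₁ (⊑-InU p) , proj₂ (⊑-InU q)
⊑-InU (⊑-⊓ᵉ {L = L} h₁@(W₁ , U₁≈W₁ , k₁) (W₂ , U₂≈W₂ , k₂)) =
  (L , W₁ ⊓ W₂ , ⊓-cong U₁≈W₁ U₂≈W₂ , ⊓D k₁ k₂) , hasDegree⇒InU h₁
⊑-InU (⊑-⊓ u v _ _)  = u , v
⊑-InU (⊑-⇒ t₁ t₂ p q) = InT⇒InU (⇒-InT (proj₂ (⊑-InU p)) t₁) , InT⇒InU (⇒-InT (proj₁ (⊑-InU p)) t₂)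
⊑-InU (⊑-e i p)      = e-InU i (proj₁ (⊑-InU p)) , e-InU i (proj₂ (⊑-InU p))

part3a : ∀ {U₁ U₂} → U₁ ⊑ U₂ → ∀ L L' → U₁ hasDegree L → U₂ hasDegree L' → L ≡ L'
part3a U₁⊑U₂ L L' h₁ h₂ = hasDegree-unique h₁ (trans (⊑-deg U₁⊑U₂) (hasDegree⇒deg h₂))

data _⊑ᶜ_ : Component → Component → Set where
  atom⊑  : ∀ K a → (K , atom a) ⊑ᶜ (K , atom a)
  arrow⊑ : ∀ K {A B A' B'} → A' ⊑ A → B ⊑ B' → (K , A ⇒ B) ⊑ᶜ (K , A' ⇒ B')

⊑ᶜ-trans : ∀ {c d e} → c ⊑ᶜ d → d ⊑ᶜ e → c ⊑ᶜ e
⊑ᶜ-trans (atom⊑ K a)    (atom⊑ .K .a)     = atom⊑ K a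
⊑ᶜ-trans (arrow⊑ K p q) (arrow⊑ .K p' q') = arrow⊑ K (⊑-trans p' p) (⊑-trans q q')

prefix-⊑ᶜ : ∀ i {c d} → c ⊑ᶜ d → prefix i c ⊑ᶜ prefix i d
prefix-⊑ᶜ i (atom⊑ K a)    = atom⊑ (i ∷ K) a
prefix-⊑ᶜ i (arrow⊑ K p q) = arrow⊑ (i ∷ K) p q

-- Equal components of well-formed types are related by ⊑ᶜ; this is where
-- completeness of ≋ is needed.
≋ᶜ⇒⊑ᶜ : ∀ {c d} → c ≋ᶜ d → InT (proj₂ d) → c ⊑ᶜ d
≋ᶜ⇒⊑ᶜ (atom≋ K a) _ = atom⊑ K a
≋ᶜ⇒⊑ᶜ (arrow≋ K p q) t with ⇒-InT-inv t
... | uA' , tB' = arrow⊑ K (⊑-refl uA' (≋⇒≈ (≋-sym p) uA' (≋-InU p uA')))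
                           (⊑-refl uB (≋⇒≈ q uB (InT⇒InU tB')))
  where uB = ≋-InU q (InT⇒InU tB')

_▹_ : Ty → Ty → Set
U ▹ V = ∀ {d} → d ∈ components V → Σ Component λ c → c ∈ components U × c ⊑ᶜ d

⊑⇒▹ : ∀ {U V} → U ⊑ V → U ▹ V
⊑⇒▹ (⊑-refl u U≈V) m with ≈⇒≋ U≈V
... | same _ _ g with g m
... | matchedBy m' p = _ , m' , ≋ᶜ⇒⊑ᶜ p (components-InT (InU-≈ u U≈V) m)
⊑⇒▹ (⊑-trans p q) m with ⊑⇒▹ q m
... | _ , m' , s' with ⊑⇒▹ p m'
... | c , m'' , s'' = c , m'' , ⊑ᶜ-trans s'' s'
⊑⇒▹ (⊑-⊓ᵉ {U₁} h₁ _) m = _ , ∈-++⁺ˡ m , ≋ᶜ⇒⊑ᶜ (≋ᶜ-refl U₁ m) (components-InT (hasDegree⇒InU h₁) m)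
⊑⇒▹ (⊑-⊓ {U₁} {V₁ = V₁} _ _ p q) m with ∈-++⁻ (components V₁) m
... | inj₁ m₁ with ⊑⇒▹ p m₁
...   | c , m' , s = c , ∈-++⁺ˡ m' , s
⊑⇒▹ (⊑-⊓ {U₁} {V₁ = V₁} _ _ p q) m | inj₂ m₂ with ⊑⇒▹ q m₂
...   | c , m' , s = c , ∈-++⁺ʳ (components U₁) m' , s
⊑⇒▹ (⊑-⇒ _ _ p q) (here refl) = _ , here refl , arrow⊑ [] p q
⊑⇒▹ (⊑-e i p) m with ∈-map⁻ (prefix i) m
... | d , m' , refl with ⊑⇒▹ p m'
... | c , m'' , s = prefix i c , ∈-map⁺ (prefix i) m'' , prefix-⊑ᶜ i s

componentless⇒ω : ∀ {U L} → U hasDegree L → (∀ {c} → ¬ c ∈ components U) → U ≈ ω L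
componentless⇒ω {U} {L} (W , U≈W , h) none with ≈⇒≋ U≈W
... | same _ _ g = U≈W ∙ subst (λ cs → W ≈ ek L (meetOf cs)) noneW (normalForm h) ∙ ek-ω L
  where
  noneW : components W ≡ []
  noneW = ⊆[]⇒≡[] (λ m → ⊥-elim (unmatched (g m)))
    where
    unmatched : ∀ {d} → ¬ MatchedBy (components U) d
    unmatched (matchedBy m _) = none m

componentless-≈ : ∀ {U V} → U ≈ V → (∀ {d} → ¬ d ∈ components V) → ∀ {c} → ¬ c ∈ components U
componentless-≈ U≈V none m with ≈⇒≋ U≈V
... | same _ f _ with f m
... | matched m' _ = none m'

part3b : ∀ {U₁ U₂} → U₁ ⊑ U₂ → ∀ K → U₁ ≈ ω K → U₂ ≈ ω K
part3b {U₁} {U₂} U₁⊑U₂ K U₁≈ω with proj₂ (⊑-InU U₁⊑U₂)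
... | L , h₂ with hasDegree-unique h₂ (trans (sym (⊑-deg U₁⊑U₂)) (deg-≈ U₁≈ω))
... | refl = componentless⇒ω h₂ noneU₂
  where
  noneU₁ : ∀ {c} → ¬ c ∈ components U₁
  noneU₁ = componentless-≈ U₁≈ω (λ ())
  noneU₂ : ∀ {c} → ¬ c ∈ components U₂
  noneU₂ m with ⊑⇒▹ U₁⊑U₂ m
  ... | _ , m' , _ = noneU₁ m'

arrows : Index → (n : ℕ) → (Us Ts : Fin (suc n) → Ty) → Ty
arrows K n Us Ts = ⨅ n (λ i → ek K (Us i ⇒ Ts i))

deg-ek-⇒ : ∀ K {A B} → deg (ek K (A ⇒ B)) ≡ just K
deg-ek-⇒ K = trans (deg-ek K refl) (cong just (++-identityʳ K))

deg-arrows : ∀ K n Us Ts → deg (arrows K n Us Ts) ≡ just K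
deg-arrows K zero    Us Ts = deg-ek-⇒ K
deg-arrows K (suc n) Us Ts =
  trans (cong₂ meetDeg (deg-ek-⇒ K) (deg-arrows K n (λ i → Us (suc i)) (λ i → Ts (suc i))))
        (meetDeg-same K)

components-ek-⇒ : ∀ K {A B c} → c ∈ components (ek K (A ⇒ B)) → c ≡ (K , A ⇒ B)
components-ek-⇒ []      (here refl) = refl
components-ek-⇒ (i ∷ K) m with ∈-map⁻ (prefix i) m
... | c , m' , refl = cong (prefix i) (components-ek-⇒ K m')

components-arrows : ∀ K n Us Ts {c} → c ∈ components (arrows K n Us Ts) →
                    Σ (Fin (suc n)) λ i → c ≡ (K , Us i ⇒ Ts i)
components-arrows K zero    Us Ts m = zero , components-ek-⇒ K m
components-arrows K (suc n) Us Ts m with ∈-++⁻ (components (ek K (Us zero ⇒ Ts zero))) m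
... | inj₁ m₁ = zero , components-ek-⇒ K m₁
... | inj₂ m₂ with components-arrows K n (λ i → Us (suc i)) (λ i → Ts (suc i)) m₂
...   | i , eq = suc i , eq

record ArrowAbove {n : ℕ} (Us Ts : Fin (suc n) → Ty) (T : Ty) : Set where
  field
    dom cod : Ty
    shape   : T ≡ dom ⇒ cod
    index   : Fin (suc n)
    dom⊑    : dom ⊑ Us index
    cod⊒    : Ts index ⊑ cod

ArrowsAbove : Index → (n : ℕ) → (Us Ts : Fin (suc n) → Ty) → Ty → Set
ArrowsAbove K n Us Ts U₂ =
  U₂ ≈ ω K ⊎
  Σ ℕ λ m → Σ (Fin (suc m) → Ty) λ Us' → Σ (Fin (suc m) → Ty) λ Ts' →
    (∀ j → InU (Us' j)) × (∀ j → InT (Ts' j)) ×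
    U₂ ≈ ⨅ m (λ j → ek K (Us' j ⇒ Ts' j)) ×
    (∀ j → Σ (Fin (suc n)) λ i → Us' j ⊑ Us i × Ts i ⊑ Ts' j)

⇒-IsT-inv : ∀ {A B} → IsT (A ⇒ B) → InU A × InT B
⇒-IsT-inv (arrT h t) = (_ , _ , ≈-refl , h) , (_ , ≈-refl , t)

normalForm-arrowsAbove : ∀ {K n Us Ts} U₂ cs → U₂ ≈ ek K (meetOf cs) → AllInT cs →
                         (∀ {c} → c ∈ cs → ArrowAbove Us Ts (proj₂ c)) → ArrowsAbove K n Us Ts U₂
normalForm-arrowsAbove {K} U₂ []       U₂≈ _ _ = inj₁ (U₂≈ ∙ ek-ω K)
normalForm-arrowsAbove {K} U₂ (c ∷ cs) U₂≈ t above =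
  inj₂ (length cs , Us' , Ts' , (λ j → proj₁ (parts j)) , (λ j → proj₂ (parts j)) , U₂≈arrows ,
        λ j → index (at j) , dom⊑ (at j) , cod⊒ (at j))
  where
  open ArrowAbove
  C : Fin (suc (length cs)) → Ty
  C j = proj₂ (lookup (c ∷ cs) j)
  at : ∀ j → ArrowAbove _ _ (C j)
  at j = above (∈-lookup j)
  Us' Ts' : Fin (suc (length cs)) → Ty
  Us' j = dom (at j)
  Ts' j = cod (at j)
  parts : ∀ j → InU (Us' j) × InT (Ts' j)
  parts j = ⇒-IsT-inv (subst IsT (shape (at j)) (t (∈-lookup j)))
  U₂≈arrows : U₂ ≈ ⨅ (length cs) (λ j → ek K (Us' j ⇒ Ts' j))
  U₂≈arrows = begin
    U₂                                    ≈⟨ U₂≈ ⟩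
    ek K (meetOf (c ∷ cs))                ≈⟨ ek-cong K (meetOf-⨅ c cs t) ⟩
    ek K (⨅ (length cs) C)                ≈⟨ ek-⨅ K (length cs) C ⟩
    ⨅ (length cs) (λ j → ek K (C j))      ≈⟨ ⨅-cong (length cs) (λ j → ek-cong K (≡⇒≈ (shape (at j)))) ⟩
    ⨅ (length cs) (λ j → ek K (Us' j ⇒ Ts' j)) ∎
    where open ≈-Reasoning

-- Part (3e): by simulation every component of U₂ lies above one of the
-- arrows of U₁, and these components determine U₂ by its normal form.
part3e : ∀ {U₁ U₂} → U₁ ⊑ U₂ → ∀ K n Us Ts → U₁ ≈ arrows K n Us Ts → ArrowsAbove K n Us Ts U₂
part3e {U₁} {U₂} U₁⊑U₂ K n Us Ts U₁≈ with ⊑-InU U₁⊑U₂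
... | u₁ , u₂@(L , W , U₂≈W , hW) with hasDegree-unique (W , ≈-refl , hW) degW
  where
  degW : deg W ≡ just K
  degW = trans (sym (deg-≈ U₂≈W)) (trans (sym (⊑-deg U₁⊑U₂)) (trans (deg-≈ U₁≈) (deg-arrows K n Us Ts)))
... | refl = normalForm-arrowsAbove U₂ (components W) (U₂≈W ∙ normalForm hW) (components-AllInT hW) above
  where
  arrows⊑W : arrows K n Us Ts ⊑ W
  arrows⊑W = ⊑-trans (⊑-refl (InU-≈ u₁ U₁≈) (≈-sym U₁≈)) (⊑-trans U₁⊑U₂ (⊑-refl u₂ U₂≈W))
  above : ∀ {d} → d ∈ components W → ArrowAbove Us Ts (proj₂ d)
  above m with ⊑⇒▹ arrows⊑W m
  ... | c , m' , c⊑d with components-arrows K n Us Ts m'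
  ... | i , refl with c⊑d
  ... | arrow⊑ _ {A' = A'} {B' = B'} p q = record
    { dom = A' ; cod = B' ; shape = refl ; index = i ; dom⊑ = p ; cod⊒ = q }

-- On terms of degree i ∷ L, strip removes the outermost expansion e_i.
strip : Ty → Ty
strip (atom a)      = atom a
strip (U ⇒ T)       = U ⇒ T
strip (ω [])        = ω []
strip (ω (i ∷ K))   = ω K
strip (U ⊓ V)       = strip U ⊓ strip V
strip (e i U)       = U

strip-HasDeg : ∀ {U i L} → HasDeg U (i ∷ L) → HasDeg (strip U) L
strip-HasDeg (ωD (i ∷ L)) = ωD L
strip-HasDeg (⊓D h₁ h₂)   = ⊓D (strip-HasDeg h₁) (strip-HasDeg h₂)
strip-HasDeg (eD i h)     = h

deg-strip : ∀ U {i L} → deg U ≡ just (i ∷ L) → deg (strip U) ≡ just L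
deg-strip (ω (j ∷ K)) refl = refl
deg-strip (U ⊓ V) {L = L} d with meetDeg-split (deg U) (deg V) d
... | dU , dV rewrite deg-strip U dU | deg-strip V dV = meetDeg-same L
deg-strip (e j U) d with prefix-just {j} {deg U} d
... | M , dU , refl = dU

strip-≈ : ∀ {U V i L} → deg U ≡ just (i ∷ L) → U ≈ V → strip U ≈ strip V
strip-≈ d ≈-refl          = ≈-refl
strip-≈ d (≈-sym p)       = ≈-sym (strip-≈ (trans (deg-≈ p) d) p)
strip-≈ d (≈-trans p q)   = strip-≈ d p ∙ strip-≈ (trans (sym (deg-≈ p)) d) q
strip-≈ () (⇒-cong p q)
strip-≈ {U ⊓ V} d (⊓-cong p q) with meetDeg-split (deg U) (deg V) d
... | dU , dV = ⊓-cong (strip-≈ dU p) (strip-≈ dV q)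
strip-≈ d (e-cong i p)    = p
strip-≈ d (⊓-comm U V)    = ⊓-comm _ _
strip-≈ d (⊓-assoc U V W) = ⊓-assoc _ _ _
strip-≈ d (⊓-idem U)      = ⊓-idem _
strip-≈ d (e-distr i U V) = ≈-refl
strip-≈ d (ω-unit {U} {L'} h) with just-injective (proj₁ (meetDeg-split (just L') (deg U) d))
... | refl = ω-unit (strip-HasDeg h)
strip-≈ d (e-ω i K)       = ≈-refl

hasDegree-deg : ∀ {U L K} → U hasDegree L → deg U ≡ just K → U hasDegree K
hasDegree-deg h d with hasDegree-unique h d
... | refl = h

strip-hasDegree : ∀ {U i L} → U hasDegree (i ∷ L) → strip U hasDegree L
strip-hasDegree h@(W , U≈W , hW) = strip W , strip-≈ (hasDegree⇒deg h) U≈W , strip-HasDeg hW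

strip-InU : ∀ {U i L} → InU U → deg U ≡ just (i ∷ L) → InU (strip U)
strip-InU {L = L} (_ , h) d = L , strip-hasDegree (hasDegree-deg h d)

strip-⊑ : ∀ {U V i L} → deg U ≡ just (i ∷ L) → U ⊑ V → strip U ⊑ strip V
strip-⊑ d (⊑-refl u U≈V) = ⊑-refl (strip-InU u d) (strip-≈ d U≈V)
strip-⊑ d (⊑-trans p q)  = ⊑-trans (strip-⊑ d p) (strip-⊑ (trans (sym (⊑-deg p)) d) q)
strip-⊑ {U₁ ⊓ U₂} d (⊑-⊓ᵉ h₁ h₂) with meetDeg-split (deg U₁) (deg U₂) d
... | d₁ , d₂ = ⊑-⊓ᵉ (strip-hasDegree (hasDegree-deg h₁ d₁)) (strip-hasDegree (hasDegree-deg h₂ d₂))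
strip-⊑ {U₁ ⊓ U₂} d r@(⊑-⊓ u v p q) with meetDeg-split (deg U₁) (deg U₂) d
... | d₁ , d₂ = ⊑-⊓ (strip-InU u d) (strip-InU v (trans (sym (⊑-deg r)) d)) (strip-⊑ d₁ p) (strip-⊑ d₂ q)
strip-⊑ () (⊑-⇒ _ _ _ _)
strip-⊑ d (⊑-e i p)      = p

e-strip-HasDeg : ∀ {W i L} → HasDeg W (i ∷ L) → W ≈ e i (strip W)
e-strip-HasDeg (ωD (i ∷ L)) = ≈-sym (e-ω i L)
e-strip-HasDeg {i = i} (⊓D h₁ h₂) = ⊓-cong (e-strip-HasDeg h₁) (e-strip-HasDeg h₂) ∙ ≈-sym (e-distr i _ _)
e-strip-HasDeg (eD i h) = ≈-refl

e-strip : ∀ {U i L} → InU U → deg U ≡ just (i ∷ L) → U ≈ e i (strip U)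
e-strip {i = i} (_ , h) d with hasDegree-deg h d
... | W , U≈W , hW = U≈W ∙ e-strip-HasDeg hW ∙ e-cong i (≈-sym (strip-≈ d U≈W))

strips : Index → Ty → Ty
strips []      U = U
strips (i ∷ K) U = strips K (strip U)

strips-ek : ∀ K U → strips K (ek K U) ≡ U
strips-ek []      U = refl
strips-ek (i ∷ K) U = strips-ek K U

strips-≈ : ∀ K {U V M} → deg U ≡ just (K ++ M) → U ≈ V → strips K U ≈ strips K V
strips-≈ []      d p = p
strips-≈ (i ∷ K) {U} d p = strips-≈ K (deg-strip U d) (strip-≈ d p)

strips-⊑ : ∀ K {U V M} → deg U ≡ just (K ++ M) → U ⊑ V → strips K U ⊑ strips K V
strips-⊑ []      d p = p
strips-⊑ (i ∷ K) {U} d p = strips-⊑ K (deg-strip U d) (strip-⊑ d p)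

strips-InU : ∀ K {U M} → InU U → deg U ≡ just (K ++ M) → InU (strips K U)
strips-InU []      u d = u
strips-InU (i ∷ K) {U} u d = strips-InU K (strip-InU u d) (deg-strip U d)

ek-strips : ∀ K {U M} → InU U → deg U ≡ just (K ++ M) → U ≈ ek K (strips K U)
ek-strips []      u d = ≈-refl
ek-strips (i ∷ K) {U} u d = e-strip u d ∙ e-cong i (ek-strips K (strip-InU u d) (deg-strip U d))

part3c : ∀ {U₁ U₂} → U₁ ⊑ U₂ → ∀ K U → InU U → U₁ ≈ ek K U →
         Σ Ty λ U' → InU U' × U₂ ≈ ek K U' × U ⊑ U'
part3c {U₁} {U₂} U₁⊑U₂ K U u U₁≈ =
  strips K U₂ , strips-InU K u₂ degU₂ , ek-strips K u₂ degU₂ ,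
  ⊑-trans (⊑-refl u U≈) (strips-⊑ K degU₁ U₁⊑U₂)
  where
  u₂    = proj₂ (⊑-InU U₁⊑U₂)
  degU₁ = trans (deg-≈ U₁≈) (deg-ek K (InU⇒deg u))
  degU₂ = trans (sym (⊑-deg U₁⊑U₂)) degU₁
  U≈ : U ≈ strips K U₁
  U≈ = subst (_≈ strips K U₁) (strips-ek K U) (strips-≈ K (deg-ek K (InU⇒deg u)) (≈-sym U₁≈))

part3d : ∀ {U₁ U₂} → U₁ ⊑ U₂ → ∀ K U → InU U → U₂ ≈ ek K U →
         Σ Ty λ U' → InU U' × U₁ ≈ ek K U' × U' ⊑ U
part3d {U₁} {U₂} U₁⊑U₂ K U u U₂≈ =
  strips K U₁ , strips-InU K u₁ degU₁ , ek-strips K u₁ degU₁ ,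
  ⊑-trans (strips-⊑ K degU₁ U₁⊑U₂) (⊑-refl (strips-InU K u₂ degU₂) ≈U)
  where
  u₁    = proj₁ (⊑-InU U₁⊑U₂)
  u₂    = proj₂ (⊑-InU U₁⊑U₂)
  degU₂ = trans (deg-≈ U₂≈) (deg-ek K (InU⇒deg u))
  degU₁ = trans (⊑-deg U₁⊑U₂) degU₂
  ≈U : strips K U₂ ≈ U
  ≈U = subst (strips K U₂ ≈_) (strips-ek K U) (strips-≈ K degU₂ U₂≈)

part3 : Part3
part3 U₁ U₂ U₁⊑U₂ =
  part3a U₁⊑U₂ , part3b U₁⊑U₂ , part3c U₁⊑U₂ , part3d U₁⊑U₂ ,
  λ K n Us Ts _ _ → part3e U₁⊑U₂ K n Us Ts

⊓-halves : ∀ {A B} → InU (A ⊓ B) → Σ Index λ L → A hasDegree L × B hasDegree L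
⊓-halves {A} {B} u@(L , h) with meetDeg-split (deg A) (deg B) (hasDegree⇒deg h)
... | dA , dB = L , rebuildDegree A dA (λ m → components-InT u (∈-++⁺ˡ m))
                  , rebuildDegree B dB (λ m → components-InT u (∈-++⁺ʳ (components A) m))

⊓-⊑ˡ : ∀ {A B} → InU (A ⊓ B) → A ⊓ B ⊑ A
⊓-⊑ˡ u with ⊓-halves u
... | _ , hA , hB = ⊑-⊓ᵉ hA hB

⊓-⊑ʳ : ∀ {A B} → InU (A ⊓ B) → A ⊓ B ⊑ B
⊓-⊑ʳ u with ⊓-halves u
... | _ , hA , hB = ⊑-trans (⊑-refl u (⊓-comm _ _)) (⊑-⊓ᵉ hB hA)

part5 : Part5
part5 U U₁' U₂' U⊑ = U , U , ≈-sym (⊓-idem U) , ⊑-trans U⊑ (⊓-⊑ˡ u') , ⊑-trans U⊑ (⊓-⊑ʳ u')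
  where u' = proj₂ (⊑-InU U⊑)

_≟ₚ_ : (p q : ℕ × Index) → Dec (p ≡ q)
_≟ₚ_ = ×-≡-dec _≟_ (≡-dec _≟_)

updateAt : Env → ℕ → Index → Maybe Ty → Env
updateAt Θ y L m x K with (y , L) ≟ₚ (x , K)
... | yes _ = m
... | no _  = Θ x K

updateAt-same : ∀ Θ y L m → updateAt Θ y L m y L ≡ m
updateAt-same Θ y L m with (y , L) ≟ₚ (y , L)
... | yes _  = refl
... | no ≢yL = ⊥-elim (≢yL refl)

updateAt-other : ∀ Θ y L m {x K} → (y , L) ≢ (x , K) → updateAt Θ y L m x K ≡ Θ x K
updateAt-other Θ y L m {x} {K} ≢xK with (y , L) ≟ₚ (x , K)
... | yes ≡xK = ⊥-elim (≢xK ≡xK)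
... | no _    = refl

extend-same : ∀ Γ y L U → extend Γ y L U y L ≡ just U
extend-same Γ y L U with y ≟ y | ≡-dec _≟_ L L
... | yes _ | yes _  = refl
... | yes _ | no L≢L = ⊥-elim (L≢L refl)
... | no y≢y | _     = ⊥-elim (y≢y refl)

extend-other : ∀ Γ y L U {x K} → (y , L) ≢ (x , K) → extend Γ y L U x K ≡ Γ x K
extend-other Γ y L U {x} {K} ≢xK with y ≟ x | ≡-dec _≟_ L K
... | yes refl | yes refl = ⊥-elim (≢xK refl)
... | yes _    | no _     = refl
... | no _     | _        = refl

≡⇒≈ᵐ : ∀ {a b} → a ≡ b → a ≈ᵐ b
≡⇒≈ᵐ {nothing} refl = nothing≈
≡⇒≈ᵐ {just _}  refl = just≈ ≈-refl

≈ₑ-at : ∀ {Γ Δ} y L → Γ y L ≡ Δ y L → (∀ {x K} → (y , L) ≢ (x , K) → Γ x K ≡ Δ x K) → Γ ≈ₑ Δ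
≈ₑ-at y L atYL elsewhere x K with (y , L) ≟ₚ (x , K)
... | yes refl = ≡⇒≈ᵐ atYL
... | no ≢xK   = ≡⇒≈ᵐ (elsewhere ≢xK)

EnvOK-at : ∀ {Θ Γ} y L → EnvOK Γ → (∀ U → Θ y L ≡ just U → InU U) →
           (∀ {x K} → (y , L) ≢ (x , K) → Θ x K ≡ Γ x K) → EnvOK Θ
EnvOK-at {Θ} y L ((ks , finite) , values) atYL elsewhere = ((y , L) ∷ ks , finite') , values'
  where
  finite' : ∀ x K U → Θ x K ≡ just U → (x , K) ∈ ((y , L) ∷ ks)
  finite' x K U eq with (y , L) ≟ₚ (x , K)
  ... | yes refl = here refl
  ... | no ≢xK   = there (finite x K U (trans (sym (elsewhere ≢xK)) eq))
  values' : ∀ x K U → Θ x K ≡ just U → InU U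
  values' x K U eq with (y , L) ≟ₚ (x , K)
  ... | yes refl = atYL U eq
  ... | no ≢xK   = values x K U (trans (sym (elsewhere ≢xK)) eq)

EnvOK-⊆ : ∀ {Γ Θ} → EnvOK Γ → (∀ x K U → Θ x K ≡ just U → Γ x K ≡ just U) → EnvOK Θ
EnvOK-⊆ ((ks , finite) , values) sub =
  (ks , λ x K U eq → finite x K U (sub x K U eq)) , λ x K U eq → values x K U (sub x K U eq)

EnvOK-≈ₑ : ∀ {Γ Δ} → EnvOK Γ → Γ ≈ₑ Δ → EnvOK Δ
EnvOK-≈ₑ {Γ} {Δ} ((ks , finite) , values) Γ≈Δ = (ks , finite') , values'
  where
  related : ∀ {a b U} → a ≈ᵐ b → b ≡ just U → Σ Ty λ U' → (a ≡ just U') × (U' ≈ U)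
  related (just≈ p) refl = _ , refl , p
  finite' : ∀ x K U → Δ x K ≡ just U → (x , K) ∈ ks
  finite' x K U eq with related (Γ≈Δ x K) eq
  ... | U' , eq' , _ = finite x K U' eq'
  values' : ∀ x K U → Δ x K ≡ just U → InU U
  values' x K U eq with related (Γ≈Δ x K) eq
  ... | U' , eq' , U'≈U = InU-≈ (values x K U' eq') U'≈U

extend-EnvOK : ∀ {Γ y L U} → EnvOK Γ → InU U → EnvOK (extend Γ y L U)
extend-EnvOK {Γ} {y} {L} {U} ok u =
  EnvOK-at y L ok (λ V eq → subst InU (just-injective (trans (sym (extend-same Γ y L U)) eq)) u)
           (extend-other Γ y L U)

infix 4 _⊑ᵐ_ _⊑ᵖ_
data _⊑ᵐ_ : Maybe Ty → Maybe Ty → Set where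
  nothing⊑ : nothing ⊑ᵐ nothing
  just⊑    : ∀ {U V} → U ⊑ V → just U ⊑ᵐ just V

_⊑ᵖ_ : Env → Env → Set
Γ ⊑ᵖ Δ = ∀ x L → Γ x L ⊑ᵐ Δ x L

⊑ᵐ-trans : ∀ {a b c} → a ⊑ᵐ b → b ⊑ᵐ c → a ⊑ᵐ c
⊑ᵐ-trans nothing⊑ nothing⊑ = nothing⊑
⊑ᵐ-trans (just⊑ p) (just⊑ q) = just⊑ (⊑-trans p q)

≈ᵐ⇒⊑ᵐ : ∀ {a b} → (∀ U → a ≡ just U → InU U) → a ≈ᵐ b → a ⊑ᵐ b
≈ᵐ⇒⊑ᵐ u nothing≈  = nothing⊑
≈ᵐ⇒⊑ᵐ u (just≈ p) = just⊑ (⊑-refl (u _ refl) p)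

⊑ᵐ-refl : ∀ {a} → (∀ U → a ≡ just U → InU U) → a ⊑ᵐ a
⊑ᵐ-refl u = ≈ᵐ⇒⊑ᵐ u (≡⇒≈ᵐ refl)

⊑ₑ⇒⊑ᵖ : ∀ {Γ Δ} → Γ ⊑ₑ Δ → EnvOK Γ × EnvOK Δ × Γ ⊑ᵖ Δ
⊑ₑ⇒⊑ᵖ (⊑ₑ-refl ok Γ≈Δ) = ok , EnvOK-≈ₑ ok Γ≈Δ , λ x L → ≈ᵐ⇒⊑ᵐ (proj₂ ok x L) (Γ≈Δ x L)
⊑ₑ⇒⊑ᵖ (⊑ₑ-trans p q) with ⊑ₑ⇒⊑ᵖ p | ⊑ₑ⇒⊑ᵖ q
... | okΓ , _ , Γ⊑Δ | _ , okΘ , Δ⊑Θ = okΓ , okΘ , λ x L → ⊑ᵐ-trans (Γ⊑Δ x L) (Δ⊑Θ x L)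
⊑ₑ⇒⊑ᵖ (⊑ₑ-ext {Γ} {y} {L} {U₁} {U₂} ok _ U₁⊑U₂) =
  extend-EnvOK {y = y} {L} ok (proj₁ (⊑-InU U₁⊑U₂)) , extend-EnvOK {y = y} {L} ok (proj₂ (⊑-InU U₁⊑U₂)) ,
  pointwise
  where
  pointwise : ∀ x K → extend Γ y L U₁ x K ⊑ᵐ extend Γ y L U₂ x K
  pointwise x K with (y , L) ≟ₚ (x , K)
  ... | yes refl rewrite extend-same Γ y L U₁ | extend-same Γ y L U₂ = just⊑ U₁⊑U₂
  ... | no ≢xK rewrite extend-other Γ y L U₁ ≢xK | extend-other Γ y L U₂ ≢xK = ⊑ᵐ-refl (proj₂ ok x K)

-- One step of the converse: replacing the declaration at y^L by a
-- pointwise larger one is a subtyping (by ⊑ₑ-ext, after removing y^L).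
⊑ₑ-updateAt : ∀ {Θ y L a b} → EnvOK Θ → Θ y L ≡ a → a ⊑ᵐ b → Θ ⊑ₑ updateAt Θ y L b
⊑ₑ-updateAt {Θ} {y} {L} ok eq nothing⊑ =
  ⊑ₑ-refl ok (≈ₑ-at y L (trans eq (sym (updateAt-same Θ y L nothing)))
                        (λ ≢xK → sym (updateAt-other Θ y L nothing ≢xK)))
⊑ₑ-updateAt {Θ} {y} {L} ok eq (just⊑ {U} {V} U⊑V) =
  ⊑ₑ-trans (⊑ₑ-refl ok Θ≈extU)
    (⊑ₑ-trans (⊑ₑ-ext ok₀ (updateAt-same Θ y L nothing) U⊑V)
              (⊑ₑ-refl (extend-EnvOK {y = y} {L} ok₀ (proj₂ (⊑-InU U⊑V))) extV≈updateV))
  where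
  Θ₀ : Env
  Θ₀ = updateAt Θ y L nothing
  ok₀ : EnvOK Θ₀
  ok₀ = EnvOK-at y L ok (λ W eq₀ → ⊥-elim (nothing≢just (trans (sym (updateAt-same Θ y L nothing)) eq₀)))
                        (updateAt-other Θ y L nothing)
    where
    nothing≢just : ∀ {W : Ty} → ¬ (nothing ≡ just W)
    nothing≢just ()
  Θ≈extU : Θ ≈ₑ extend Θ₀ y L U
  Θ≈extU = ≈ₑ-at y L (trans eq (sym (extend-same Θ₀ y L U)))
                     (λ ≢xK → sym (trans (extend-other Θ₀ y L U ≢xK) (updateAt-other Θ y L nothing ≢xK)))
  extV≈updateV : extend Θ₀ y L V ≈ₑ updateAt Θ y L (just V)
  extV≈updateV = ≈ₑ-at y L (trans (extend-same Θ₀ y L V) (sym (updateAt-same Θ y L (just V))))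
                           (λ ≢xK → trans (extend-other Θ₀ y L V ≢xK)
                                     (trans (updateAt-other Θ y L nothing ≢xK)
                                            (sym (updateAt-other Θ y L (just V) ≢xK))))

-- Completeness, by induction on a list ks outside of which Γ and Δ agree:
-- move Γ towards Δ one declaration of ks at a time.
⊑ᵖ⇒⊑ₑ-outside : ∀ ks {Γ Δ} → EnvOK Γ → EnvOK Δ → Γ ⊑ᵖ Δ →
                (∀ x K → ¬ (x , K) ∈ ks → Γ x K ≡ Δ x K) → Γ ⊑ₑ Δ
⊑ᵖ⇒⊑ₑ-outside [] okΓ _ _ agree = ⊑ₑ-refl okΓ (λ x K → ≡⇒≈ᵐ (agree x K (λ ())))
⊑ᵖ⇒⊑ₑ-outside ((y , L) ∷ ks) {Γ} {Δ} okΓ okΔ Γ⊑Δ agree =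
  ⊑ₑ-trans (⊑ₑ-updateAt okΓ refl (Γ⊑Δ y L)) (⊑ᵖ⇒⊑ₑ-outside ks okΘ okΔ Θ⊑Δ agreeΘ)
  where
  Θ : Env
  Θ = updateAt Γ y L (Δ y L)
  okΘ : EnvOK Θ
  okΘ = EnvOK-at y L okΓ (λ U eq → proj₂ okΔ y L U (trans (sym (updateAt-same Γ y L (Δ y L))) eq))
                         (updateAt-other Γ y L (Δ y L))
  Θ⊑Δ : Θ ⊑ᵖ Δ
  Θ⊑Δ x K with (y , L) ≟ₚ (x , K)
  ... | yes refl = ⊑ᵐ-refl (proj₂ okΔ y L)
  ... | no ≢xK   = Γ⊑Δ x K
  agreeΘ : ∀ x K → ¬ (x , K) ∈ ks → Θ x K ≡ Δ x K
  agreeΘ x K ∉ks with (y , L) ≟ₚ (x , K)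
  ... | yes refl = refl
  ... | no ≢xK   = agree x K λ { (here ≡yL) → ≢xK (sym ≡yL) ; (there ∈ks) → ∉ks ∈ks }

-- Completeness: outside the finite domain of Γ both environments are empty.
⊑ᵖ⇒⊑ₑ : ∀ {Γ Δ} → EnvOK Γ → EnvOK Δ → Γ ⊑ᵖ Δ → Γ ⊑ₑ Δ
⊑ᵖ⇒⊑ₑ {Γ} {Δ} okΓ@((ks , finite) , _) okΔ Γ⊑Δ = ⊑ᵖ⇒⊑ₑ-outside ks okΓ okΔ Γ⊑Δ outside
  where
  outside : ∀ x K → ¬ (x , K) ∈ ks → Γ x K ≡ Δ x K
  outside x K ∉ks with Γ x K in eq | Δ x K | Γ⊑Δ x K
  ... | just U  | _       | _        = ⊥-elim (∉ks (finite x K U eq))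
  ... | nothing | nothing | nothing⊑ = refl

onDomain : Maybe Ty → Maybe Ty → Maybe Ty
onDomain (just _) m = m
onDomain nothing  _ = nothing

infixl 7 _↾_
_↾_ : Env → Env → Env
(Γ ↾ Δ) x K = onDomain (Δ x K) (Γ x K)

onDomain-⊆ : ∀ a m {U} → onDomain a m ≡ just U → m ≡ just U
onDomain-⊆ (just _) m eq = eq

meetᵐ-onDomain : ∀ g a b → g ⊑ᵐ meetᵐ a b → g ≈ᵐ meetᵐ (onDomain a g) (onDomain b g)
meetᵐ-onDomain (just U) (just _) (just _) (just⊑ _) = just≈ (≈-sym (⊓-idem U))
meetᵐ-onDomain (just U) (just _) nothing  (just⊑ _) = just≈ ≈-refl
meetᵐ-onDomain (just U) nothing  (just _) (just⊑ _) = just≈ ≈-refl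
meetᵐ-onDomain nothing  nothing  nothing  nothing⊑  = nothing≈
meetᵐ-onDomain nothing  (just _) (just _) ()
meetᵐ-onDomain nothing  (just _) nothing  ()

onDomain-⊑ˡ : ∀ g a b → g ⊑ᵐ meetᵐ a b → (∀ W → meetᵐ a b ≡ just W → InU W) → onDomain a g ⊑ᵐ a
onDomain-⊑ˡ g (just A) (just B) (just⊑ p) u = just⊑ (⊑-trans p (⊓-⊑ˡ (u _ refl)))
onDomain-⊑ˡ g (just A) nothing  (just⊑ p) u = just⊑ p
onDomain-⊑ˡ g nothing  b        r         u = nothing⊑

onDomain-⊑ʳ : ∀ g a b → g ⊑ᵐ meetᵐ a b → (∀ W → meetᵐ a b ≡ just W → InU W) → onDomain b g ⊑ᵐ b
onDomain-⊑ʳ g (just A) (just B) (just⊑ p) u = just⊑ (⊑-trans p (⊓-⊑ʳ (u _ refl)))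
onDomain-⊑ʳ g nothing  (just B) (just⊑ p) u = just⊑ p
onDomain-⊑ʳ g a        nothing  r         u = nothing⊑

-- Part (6): take Γᵢ = Γ ↾ Γᵢ'; the pointwise facts above lift to
-- environments by the characterisation of ⊑ₑ.
part6 : Part6
part6 Γ Γ₁' Γ₂' ok₁' ok₂' ok₁₂' Γ⊑ with ⊑ₑ⇒⊑ᵖ Γ⊑
... | okΓ , _ , Γ⊑ᵖ =
  Γ ↾ Γ₁' , Γ ↾ Γ₂' , ok₁ , ok₂ , EnvOK-≈ₑ okΓ Γ≈ , Γ≈ ,
  ⊑ᵖ⇒⊑ₑ ok₁ ok₁' (λ x K → onDomain-⊑ˡ (Γ x K) (Γ₁' x K) (Γ₂' x K) (Γ⊑ᵖ x K) (proj₂ ok₁₂' x K)) ,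
  ⊑ᵖ⇒⊑ₑ ok₂ ok₂' (λ x K → onDomain-⊑ʳ (Γ x K) (Γ₁' x K) (Γ₂' x K) (Γ⊑ᵖ x K) (proj₂ ok₁₂' x K))
  where
  ok₁ : EnvOK (Γ ↾ Γ₁')
  ok₁ = EnvOK-⊆ okΓ (λ x K U → onDomain-⊆ (Γ₁' x K) (Γ x K))
  ok₂ : EnvOK (Γ ↾ Γ₂')
  ok₂ = EnvOK-⊆ okΓ (λ x K U → onDomain-⊆ (Γ₂' x K) (Γ x K))
  Γ≈ : Γ ≈ₑ Γ ↾ Γ₁' ⊓ₑ Γ ↾ Γ₂'
  Γ≈ x K = meetᵐ-onDomain (Γ x K) (Γ₁' x K) (Γ₂' x K) (Γ⊑ᵖ x K)

lemma2 : Part1 × Part2 × Part3 × Part4 × Part5 × Part6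
lemma2 = part1 , part2 , part3 , part4 , part5 , part6
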